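{- Honeycomb arrays of order $m$ exist for only a finite number of values of $m$.
   Context: Represent the hexagonal grid by $\mathbb{Z}^2$, where $(i,j)$ (column $i$, row $j$) has neighbours $(i\pm1,j)$, $(i,j\pm1)$, $(i+1,j+1)$, $(i-1,j-1)$; this is the hexagonal tiling's adjacency graph (identify $(i,j)$ with the plane point $i(1,0)+j(-\tfrac12,\tfrac{\sqrt3}{2})$). A set of dots is a distinct difference configuration if the vectors $a-b$, over ordered pairs $(a,b)$ of distinct dots, are pairwise distinct. A honeycomb array of order $m$ is a set of $m$ dots in the hexagonal grid forming a distinct difference configuration such that, in this $\mathbb{Z}^2$ representation, the dots form an $m\times m$ Costas array (i.e. they lie in $m$ consecutive columns and $m$ consecutive rows, with exactly one dot in each of these columns and each of these rows) and all dots lie in $m$ consecutive "North-East" diagonals, i.e. the values $j-i$ over dots $(i,j)$ lie in a set of $m$ consecutive integers. -}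

module Defs where

open import Data.Nat using (ℕ)
open import Data.Integer using (ℤ; _+_; _-_; _≤_; _<_; +_)
open import Data.Fin using (Fin; toℕ)
open import Data.Product using (_×_; _,_; proj₁; proj₂; Σ; ∃)
open import Relation.Binary.PropositionalEquality using (_≡_; _≢_)

-- A point (i , j) of the hexagonal grid: column i, row j.
Point : Set
Point = ℤ × ℤ

col : Point → ℤ
col = proj₁

row : Point → ℤ
row = proj₂

diff : Point → Point → Point
diff (i , j) (k , l) = (i - k , j - l)

Config : ℕ → Set
Config m = Fin m → Point

DistinctDots : ∀ {m} → Config m → Set
DistinctDots {m} d = ∀ (s t : Fin m) → d s ≡ d t → s ≡ t

DDC : ∀ {m} → Config m → Set
DDC {m} d = ∀ (a b a' b' : Fin m) → a ≢ b → a' ≢ b' →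
  diff (d a) (d b) ≡ diff (d a') (d b') → (a ≡ a') × (b ≡ b')

ExactlyOne : ∀ {m} → (Fin m → Set) → Set
ExactlyOne {m} P = Σ (Fin m) λ t → P t × (∀ (t' : Fin m) → P t' → t' ≡ t)

OnePerLine : ∀ {m} → (Point → ℤ) → Config m → Set
OnePerLine {m} f d = Σ ℤ λ c →
  (∀ (t : Fin m) → (c ≤ f (d t)) × (f (d t) < c + + m)) ×
  (∀ (k : Fin m) → ExactlyOne {m} (λ t → f (d t) ≡ c + + toℕ k))

Costas : ∀ {m} → Config m → Set
Costas d = OnePerLine col d × OnePerLine row d

-- North-East diagonal index j - i
diag : Point → ℤ
diag (i , j) = j - i

InConsecutiveDiagonals : ∀ {m} → Config m → Set
InConsecutiveDiagonals {m} d = Σ ℤ λ e →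
  ∀ (t : Fin m) → (e ≤ diag (d t)) × (diag (d t) < e + + m)

IsHoneycombArray : ∀ {m} → Config m → Set
IsHoneycombArray d = DistinctDots d × DDC d × Costas d × InConsecutiveDiagonals d

HoneycombArrayExists : ℕ → Set
HoneycombArrayExists m = Σ (Config m) IsHoneycombArray

module Submission where

-- A window-counting argument in the style of Erdős and Turán.  Translate a honeycomb
-- array so that its dots (X, Y) lie in [0, m)² with X ≤ Y + K < X + m, and consider the
-- k × k windows with corners in [0, m + k − 1)².  Every dot lies in k² windows, so the
-- window loads sum to m k², and only the T windows meeting the strip X ≤ Y + K < X + m
-- can be loaded; counting them gives 4T + (m + k − 1)² ≤ 2(m + k − 1)(2m + 3k − 3) + 1,
-- i.e. T ≈ 3m²/4.  The sum of the squared loads counts pairs of dots sharing a window: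
-- the m diagonal pairs give m k², and since the difference vectors are distinct the other
-- pairs give at most k⁴.  Cauchy–Schwarz yields m² k² ≤ T (m + k²), which fails for
-- k = 3⌊√m⌋ + 1 once m > 4900.

open import Defs
open import Data.Nat using (ℕ; zero; suc; _+_; _*_; _∸_; _≤_; _<_; z≤n; s≤s; ∣_-_∣; _≤?_; _<?_; >-nonZero)
open import Data.Nat.Properties
open import Data.Nat.Tactic.RingSolver using (solve-∀; solve)
open import Data.List using (List; []; _∷_; _++_; _∷ʳ_; map; length; upTo; applyUpTo; allFin; tabulate; cartesianProduct)
open import Data.List.Properties using (upTo-∷ʳ; length-upTo; length-tabulate)
open import Data.List.Membership.Propositional using (_∈_)
open import Data.List.Membership.Propositional.Properties using (∈-upTo⁺; ∈-upTo⁻; ∈-cartesianProduct⁺; ∈-∃++; ∈-++⁻; ∈-++⁺ˡ; ∈-++⁺ʳ)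
open import Data.List.Relation.Unary.Any using (here; there)
open import Data.List.Relation.Unary.All as All using ()
open import Data.List.Relation.Unary.AllPairs using (_∷_)
open import Data.List.Relation.Unary.Unique.Propositional using (Unique)
open import Data.List.Relation.Unary.Unique.Propositional.Properties using (cartesianProduct⁺; allFin⁺)
open import Data.Fin using (Fin; zero; suc)
open import Data.Integer as ℤ using (ℤ)
import Data.Integer.Properties as ℤ
import Data.Integer.Tactic.RingSolver as ℤ
import Data.Fin.Properties as Fin
open import Data.Product using (Σ; _×_; _,_; proj₁; proj₂; uncurry)
open import Data.Sum using (_⊎_; inj₁; inj₂)
open import Data.Empty using (⊥-elim)
open import Function using (_∘_; id)
open import Relation.Nullary using (¬_; yes; no)
open import Relation.Binary.PropositionalEquality

private variable A B : Set

∑ : List A → (A → ℕ) → ℕ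
∑ [] f = 0
∑ (x ∷ xs) f = f x + ∑ xs f

∑-cong : (xs : List A) {f g : A → ℕ} → (∀ x → f x ≡ g x) → ∑ xs f ≡ ∑ xs g
∑-cong [] f≡g = refl
∑-cong (x ∷ xs) f≡g = cong₂ _+_ (f≡g x) (∑-cong xs f≡g)

∑-mono-∈ : (xs : List A) {f g : A → ℕ} → (∀ x → x ∈ xs → f x ≤ g x) → ∑ xs f ≤ ∑ xs g
∑-mono-∈ [] f≤g = z≤n
∑-mono-∈ (x ∷ xs) f≤g = +-mono-≤ (f≤g x (here refl)) (∑-mono-∈ xs (λ y y∈xs → f≤g y (there y∈xs)))

∑-mono : (xs : List A) {f g : A → ℕ} → (∀ x → f x ≤ g x) → ∑ xs f ≤ ∑ xs g
∑-mono xs f≤g = ∑-mono-∈ xs (λ x _ → f≤g x)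

∑-distrib-+ : (xs : List A) (f g : A → ℕ) → ∑ xs (λ x → f x + g x) ≡ ∑ xs f + ∑ xs g
∑-distrib-+ [] f g = refl
∑-distrib-+ (x ∷ xs) f g = begin
  f x + g x + ∑ xs (λ x → f x + g x) ≡⟨ cong (f x + g x +_) (∑-distrib-+ xs f g) ⟩
  f x + g x + (∑ xs f + ∑ xs g)      ≡⟨ +-+-exchange (f x) (g x) _ _ ⟩
  f x + ∑ xs f + (g x + ∑ xs g)      ∎
  where
  open ≡-Reasoning
  +-+-exchange : ∀ a b c d → a + b + (c + d) ≡ a + c + (b + d)
  +-+-exchange = solve-∀

∑-*ˡ : (xs : List A) (c : ℕ) (f : A → ℕ) → ∑ xs (λ x → c * f x) ≡ c * ∑ xs f
∑-*ˡ [] c f = sym (*-zeroʳ c)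
∑-*ˡ (x ∷ xs) c f = trans (cong (c * f x +_) (∑-*ˡ xs c f)) (sym (*-distribˡ-+ c (f x) _))

∑-*ʳ : (xs : List A) (c : ℕ) (f : A → ℕ) → ∑ xs (λ x → f x * c) ≡ ∑ xs f * c
∑-*ʳ [] c f = refl
∑-*ʳ (x ∷ xs) c f = trans (cong (f x * c +_) (∑-*ʳ xs c f)) (sym (*-distribʳ-+ c (f x) _))

∑-++ : (xs ys : List A) (f : A → ℕ) → ∑ (xs ++ ys) f ≡ ∑ xs f + ∑ ys f
∑-++ [] ys f = refl
∑-++ (x ∷ xs) ys f = trans (cong (f x +_) (∑-++ xs ys f)) (sym (+-assoc (f x) _ _))

∑-const : (xs : List A) (c : ℕ) → ∑ xs (λ _ → c) ≡ length xs * c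
∑-const [] c = refl
∑-const (x ∷ xs) c = cong (c +_) (∑-const xs c)

∑-zero : (xs : List A) → ∑ xs (λ _ → 0) ≡ 0
∑-zero xs = trans (∑-const xs 0) (*-zeroʳ (length xs))

∑-map : (xs : List A) (g : A → B) (f : B → ℕ) → ∑ (map g xs) f ≡ ∑ xs (f ∘ g)
∑-map [] g f = refl
∑-map (x ∷ xs) g f = cong (f (g x) +_) (∑-map xs g f)

∑-comm : (xs : List A) (ys : List B) (f : A → B → ℕ) →
  ∑ xs (λ x → ∑ ys (f x)) ≡ ∑ ys (λ y → ∑ xs (λ x → f x y))
∑-comm [] ys f = sym (∑-zero ys)
∑-comm (x ∷ xs) ys f = trans (cong (∑ ys (f x) +_) (∑-comm xs ys f))
  (sym (∑-distrib-+ ys (f x) (λ y → ∑ xs (λ x' → f x' y))))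

∑-cartesianProduct : (xs : List A) (ys : List B) (f : A × B → ℕ) →
  ∑ (cartesianProduct xs ys) f ≡ ∑ xs (λ x → ∑ ys (λ y → f (x , y)))
∑-cartesianProduct [] ys f = refl
∑-cartesianProduct (x ∷ xs) ys f = trans (∑-++ (map (x ,_) ys) _ f)
  (cong₂ _+_ (∑-map ys (x ,_) f) (∑-cartesianProduct xs ys f))

∑*∑ : (xs : List A) (ys : List B) (f : A → ℕ) (g : B → ℕ) →
  ∑ xs f * ∑ ys g ≡ ∑ xs (λ x → ∑ ys (λ y → f x * g y))
∑*∑ xs ys f g = trans (sym (∑-*ʳ xs (∑ ys g) f)) (∑-cong xs (λ x → sym (∑-*ˡ ys (f x) g)))

∑-applyUpTo : ∀ n (g : ℕ → A) (f : A → ℕ) → ∑ (applyUpTo g n) f ≡ ∑ (upTo n) (f ∘ g)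
∑-applyUpTo zero g f = refl
∑-applyUpTo (suc n) g f = cong (f (g 0) +_)
  (trans (∑-applyUpTo n (g ∘ suc) f) (sym (∑-applyUpTo n suc (f ∘ g))))

∑-upTo-suc : ∀ n (f : ℕ → ℕ) → ∑ (upTo (suc n)) f ≡ f 0 + ∑ (upTo n) (f ∘ suc)
∑-upTo-suc n f = cong (f 0 +_) (∑-applyUpTo n suc f)

∑-upTo-∷ʳ : ∀ n (f : ℕ → ℕ) → ∑ (upTo (suc n)) f ≡ ∑ (upTo n) f + f n
∑-upTo-∷ʳ n f = begin
  ∑ (upTo (suc n)) f       ≡⟨ cong (λ xs → ∑ xs f) (sym (upTo-∷ʳ n)) ⟩
  ∑ (upTo n ∷ʳ n) f        ≡⟨ ∑-++ (upTo n) (n ∷ []) f ⟩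
  ∑ (upTo n) f + (f n + 0) ≡⟨ cong (∑ (upTo n) f +_) (+-identityʳ (f n)) ⟩
  ∑ (upTo n) f + f n       ∎
  where open ≡-Reasoning

∑-upTo-+ : ∀ c j (f : ℕ → ℕ) → ∑ (upTo (c + j)) f ≡ ∑ (upTo c) f + ∑ (upTo j) (λ i → f (c + i))
∑-upTo-+ c zero    f = trans (cong (λ n → ∑ (upTo n) f) (+-identityʳ c)) (sym (+-identityʳ _))
∑-upTo-+ c (suc j) f = begin
  ∑ (upTo (c + suc j)) f                               ≡⟨ cong (λ n → ∑ (upTo n) f) (+-suc c j) ⟩
  ∑ (upTo (suc (c + j))) f                             ≡⟨ ∑-upTo-∷ʳ (c + j) f ⟩
  ∑ (upTo (c + j)) f + f (c + j)                       ≡⟨ cong (_+ f (c + j)) (∑-upTo-+ c j f) ⟩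
  ∑ (upTo c) f + ∑ (upTo j) g + f (c + j)              ≡⟨ +-assoc (∑ (upTo c) f) _ _ ⟩
  ∑ (upTo c) f + (∑ (upTo j) g + g j)                  ≡⟨ cong (∑ (upTo c) f +_) (sym (∑-upTo-∷ʳ j g)) ⟩
  ∑ (upTo c) f + ∑ (upTo (suc j)) g                    ∎
  where
  open ≡-Reasoning
  g : ℕ → ℕ
  g i = f (c + i)

∑-upTo-≤-support : ∀ c k (f : ℕ → ℕ) → (∀ i → k ≤ i → f i ≡ 0) → ∑ (upTo c) f ≤ ∑ (upTo k) f
∑-upTo-≤-support c k f vanish = begin
  ∑ (upTo c) f                                       ≤⟨ m≤m+n _ _ ⟩
  ∑ (upTo c) f + ∑ (upTo k) (λ i → f (c + i))        ≡⟨ sym (∑-upTo-+ c k f) ⟩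
  ∑ (upTo (c + k)) f                                 ≡⟨ cong (λ n → ∑ (upTo n) f) (+-comm c k) ⟩
  ∑ (upTo (k + c)) f                                 ≡⟨ ∑-upTo-+ k c f ⟩
  ∑ (upTo k) f + ∑ (upTo c) (λ i → f (k + i))        ≡⟨ cong (∑ (upTo k) f +_) (trans
                                                         (∑-cong (upTo c) (λ i → vanish (k + i) (m≤m+n k i)))
                                                         (∑-zero (upTo c))) ⟩
  ∑ (upTo k) f + 0                                   ≡⟨ +-identityʳ _ ⟩
  ∑ (upTo k) f                                       ∎
  where open ≤-Reasoning

∑-tabulate : ∀ n (g : Fin n → A) (f : A → ℕ) → ∑ (tabulate g) f ≡ ∑ (allFin n) (f ∘ g)
∑-tabulate zero g f = refl
∑-tabulate (suc n) g f = cong (f (g zero) +_)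
  (trans (∑-tabulate n (g ∘ suc) f) (sym (∑-tabulate n suc (f ∘ g))))

∑-allFin-suc : ∀ n (f : Fin (suc n) → ℕ) → ∑ (allFin (suc n)) f ≡ f zero + ∑ (allFin n) (f ∘ suc)
∑-allFin-suc n f = cong (f zero +_) (∑-tabulate n suc f)

length-allFin : ∀ n → length (allFin n) ≡ n
length-allFin n = length-tabulate id

offDiagonal : ∀ {m} → Fin m → Fin m → ℕ → ℕ
offDiagonal zero    zero    x = 0
offDiagonal zero    (suc b) x = x
offDiagonal (suc a) zero    x = x
offDiagonal (suc a) (suc b) x = offDiagonal a b x

offDiagonal-cases : ∀ {m} (a b : Fin m) x → offDiagonal a b x ≡ 0 ⊎ (a ≢ b × offDiagonal a b x ≡ x)
offDiagonal-cases zero    zero    x = inj₁ refl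
offDiagonal-cases zero    (suc b) x = inj₂ ((λ ()) , refl)
offDiagonal-cases (suc a) zero    x = inj₂ ((λ ()) , refl)
offDiagonal-cases (suc a) (suc b) x with offDiagonal-cases a b x
... | inj₁ e        = inj₁ e
... | inj₂ (a≢b , e) = inj₂ ((λ sa≡sb → a≢b (Fin.suc-injective sa≡sb)) , e)

∑-split-diagonal : ∀ n (a : Fin n) (g : Fin n → ℕ) →
  ∑ (allFin n) g ≡ g a + ∑ (allFin n) (λ b → offDiagonal a b (g b))
∑-split-diagonal (suc n) zero    g = begin
  ∑ (allFin (suc n)) g                   ≡⟨ ∑-allFin-suc n g ⟩
  g zero + ∑ (allFin n) (g ∘ suc)        ≡⟨ cong (g zero +_) (sym (∑-allFin-suc n (λ b → offDiagonal zero b (g b)))) ⟩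
  g zero + ∑ (allFin (suc n)) (λ b → offDiagonal zero b (g b)) ∎
  where open ≡-Reasoning
∑-split-diagonal (suc n) (suc a) g = begin
  ∑ (allFin (suc n)) g                   ≡⟨ ∑-allFin-suc n g ⟩
  g zero + ∑ (allFin n) (g ∘ suc)        ≡⟨ cong (g zero +_) (∑-split-diagonal n a (g ∘ suc)) ⟩
  g zero + (g (suc a) + S)               ≡⟨ exchange (g zero) (g (suc a)) S ⟩
  g (suc a) + (g zero + S)               ≡⟨ cong (g (suc a) +_) (sym (∑-allFin-suc n (λ b → offDiagonal (suc a) b (g b)))) ⟩
  g (suc a) + ∑ (allFin (suc n)) (λ b → offDiagonal (suc a) b (g b)) ∎
  where
  open ≡-Reasoning
  S = ∑ (allFin n) (λ b → offDiagonal a b (g (suc b)))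
  exchange : ∀ a b c → a + (b + c) ≡ b + (a + c)
  exchange = solve-∀

∑-≤-injection : (xs : List A) {ys : List B} {f : A → ℕ} {g : B → ℕ} (e : A → B) (S : A → Set) →
  Unique xs →
  (∀ x → f x ≡ 0 ⊎ (S x × f x ≡ g (e x))) →
  (∀ {x y} → S x → S y → e x ≡ e y → x ≡ y) →
  (∀ {x} → x ∈ xs → S x → e x ∈ ys) →
  ∑ xs f ≤ ∑ ys g
∑-≤-injection [] e S _ _ _ _ = z≤n
∑-≤-injection (x ∷ xs) {ys} {f} {g} e S (x∉xs ∷ unique) f-cases e-inj e∈ys with f-cases x
... | inj₁ fx≡0 = begin
  f x + ∑ xs f ≡⟨ cong (_+ ∑ xs f) fx≡0 ⟩
  ∑ xs f       ≤⟨ ∑-≤-injection xs e S unique f-cases e-inj (e∈ys ∘ there) ⟩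
  ∑ ys g       ∎
  where open ≤-Reasoning
... | inj₂ (Sx , fx≡gex) with ∈-∃++ (e∈ys (here refl) Sx)
...   | ys₁ , ys₂ , refl = begin
  f x + ∑ xs f                     ≤⟨ +-mono-≤ (≤-reflexive fx≡gex) rest ⟩
  g (e x) + ∑ (ys₁ ++ ys₂) g       ≡⟨ cong (g (e x) +_) (∑-++ ys₁ ys₂ g) ⟩
  g (e x) + (∑ ys₁ g + ∑ ys₂ g)    ≡⟨ +-exchange (g (e x)) (∑ ys₁ g) (∑ ys₂ g) ⟩
  ∑ ys₁ g + (g (e x) + ∑ ys₂ g)    ≡⟨ sym (∑-++ ys₁ (e x ∷ ys₂) g) ⟩
  ∑ (ys₁ ++ e x ∷ ys₂) g           ∎
  where
  open ≤-Reasoning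
  +-exchange : ∀ a b c → a + (b + c) ≡ b + (a + c)
  +-exchange = solve-∀
  e∈ys₁++ys₂ : ∀ {y} → y ∈ xs → S y → e y ∈ ys₁ ++ ys₂
  e∈ys₁++ys₂ y∈xs Sy with ∈-++⁻ ys₁ (e∈ys (there y∈xs) Sy)
  ... | inj₁ ey∈ys₁         = ∈-++⁺ˡ ey∈ys₁
  ... | inj₂ (here ey≡ex)   = ⊥-elim (All.lookup x∉xs y∈xs (sym (e-inj Sy Sx ey≡ex)))
  ... | inj₂ (there ey∈ys₂) = ∈-++⁺ʳ ys₁ ey∈ys₂
  rest : ∑ xs f ≤ ∑ (ys₁ ++ ys₂) g
  rest = ∑-≤-injection xs e S unique f-cases e-inj e∈ys₁++ys₂

4x[x+d]≤[x+[x+d]]² : ∀ x d → 4 * x * (x + d) ≤ (x + (x + d)) * (x + (x + d))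
4x[x+d]≤[x+[x+d]]² x d = subst (4 * x * (x + d) ≤_) (sym (square-identity x d)) (m≤m+n _ (d * d))
  where
  square-identity : ∀ x d → (x + (x + d)) * (x + (x + d)) ≡ 4 * x * (x + d) + d * d
  square-identity = solve-∀

4xy≤[x+y]² : ∀ x y → 4 * x * y ≤ (x + y) * (x + y)
4xy≤[x+y]² x y with ≤-total x y
... | inj₁ x≤y = subst (λ z → 4 * x * z ≤ (x + z) * (x + z)) (m+[n∸m]≡n x≤y)
  (4x[x+d]≤[x+[x+d]]² x (y ∸ x))
... | inj₂ y≤x = subst₂ _≤_ (swap y x) (cong (λ z → z * z) (+-comm y x))
  (subst (λ z → 4 * y * z ≤ (y + z) * (y + z)) (m+[n∸m]≡n y≤x) (4x[x+d]≤[x+[x+d]]² y (x ∸ y)))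
  where
  swap : ∀ y x → 4 * y * x ≡ 4 * x * y
  swap = solve-∀

*-self-cancel-≤ : ∀ {x y} → x * x ≤ y * y → x ≤ y
*-self-cancel-≤ {x} {y} x²≤y² with x ≤? y
... | yes x≤y = x≤y
... | no x≰y = ⊥-elim (<⇒≱ (*-mono-< (≰⇒> x≰y) (≰⇒> x≰y)) x²≤y²)

cauchy-schwarz-step : ∀ S A B a b → S * S ≤ A * B →
  (a * b + S) * (a * b + S) ≤ (a * a + A) * (b * b + B)
cauchy-schwarz-step S A B a b S²≤AB = begin
  (a * b + S) * (a * b + S)                          ≡⟨ solve (S ∷ a ∷ b ∷ []) ⟩
  a * a * (b * b) + 2 * S * (a * b) + S * S          ≤⟨ +-mono-≤ (+-monoʳ-≤ (a * a * (b * b)) cross) S²≤AB ⟩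
  a * a * (b * b) + (A * (b * b) + a * a * B) + A * B ≡⟨ solve (A ∷ B ∷ a ∷ b ∷ []) ⟩
  (a * a + A) * (b * b + B)                          ∎
  where
  open ≤-Reasoning
  -- AM–GM, after squaring both sides
  cross : 2 * S * (a * b) ≤ A * (b * b) + a * a * B
  cross = *-self-cancel-≤ (begin
    (2 * S * (a * b)) * (2 * S * (a * b)) ≡⟨ solve (S ∷ a ∷ b ∷ []) ⟩
    4 * (S * S) * (a * a * (b * b))       ≤⟨ *-monoˡ-≤ (a * a * (b * b)) (*-monoʳ-≤ 4 S²≤AB) ⟩
    4 * (A * B) * (a * a * (b * b))       ≡⟨ solve (A ∷ B ∷ a ∷ b ∷ []) ⟩
    4 * (A * (b * b)) * (a * a * B)       ≤⟨ 4xy≤[x+y]² (A * (b * b)) (a * a * B) ⟩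
    (A * (b * b) + a * a * B) * (A * (b * b) + a * a * B) ∎)

cauchy-schwarz : (xs : List A) (f g : A → ℕ) →
  ∑ xs (λ x → f x * g x) * ∑ xs (λ x → f x * g x) ≤ ∑ xs (λ x → f x * f x) * ∑ xs (λ x → g x * g x)
cauchy-schwarz [] f g = z≤n
cauchy-schwarz (x ∷ xs) f g = cauchy-schwarz-step _ _ _ (f x) (g x) (cauchy-schwarz xs f g)

Is01 : ℕ → Set
Is01 n = n ≡ 0 ⊎ n ≡ 1

01⇒≤1 : ∀ {n} → Is01 n → n ≤ 1
01⇒≤1 (inj₁ refl) = z≤n
01⇒≤1 (inj₂ refl) = ≤-refl

01⇒*-idem : ∀ {n} → Is01 n → n * n ≡ n
01⇒*-idem (inj₁ refl) = refl
01⇒*-idem (inj₂ refl) = refl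

01-* : ∀ {m n} → Is01 m → Is01 n → Is01 (m * n)
01-* (inj₁ refl) _ = inj₁ refl
01-* (inj₂ refl) (inj₁ refl) = inj₁ refl
01-* (inj₂ refl) (inj₂ refl) = inj₂ refl

01-*-support : ∀ {x y} → Is01 y → (y ≡ 1 → x ≡ 1) → x * y ≡ y
01-*-support {x} (inj₁ refl) _    = *-zeroʳ x
01-*-support {x} (inj₂ refl) y≡1⇒x≡1 = trans (*-identityʳ x) (y≡1⇒x≡1 refl)

*-≤1ʳ : ∀ m {n} → n ≤ 1 → m * n ≤ m
*-≤1ʳ m n≤1 = ≤-trans (*-monoʳ-≤ m n≤1) (≤-reflexive (*-identityʳ m))

*-≤1ˡ : ∀ {m} n → m ≤ 1 → m * n ≤ n
*-≤1ˡ n m≤1 = ≤-trans (*-monoˡ-≤ n m≤1) (≤-reflexive (+-identityʳ n))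

𝟙[_<_] : ℕ → ℕ → ℕ
𝟙[ _     < zero  ] = 0
𝟙[ zero  < suc _ ] = 1
𝟙[ suc a < suc b ] = 𝟙[ a < b ]

𝟙<-01 : ∀ a b → Is01 𝟙[ a < b ]
𝟙<-01 _       zero    = inj₁ refl
𝟙<-01 zero    (suc _) = inj₂ refl
𝟙<-01 (suc a) (suc b) = 𝟙<-01 a b

𝟙<-sound : ∀ a b → 𝟙[ a < b ] ≡ 1 → a < b
𝟙<-sound zero    (suc b) _ = s≤s z≤n
𝟙<-sound (suc a) (suc b) e = s≤s (𝟙<-sound a b e)

𝟙<-complete : ∀ {a b} → a < b → 𝟙[ a < b ] ≡ 1
𝟙<-complete {zero}  {suc b} _         = refl
𝟙<-complete {suc a} {suc b} (s≤s a<b) = 𝟙<-complete a<b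

-- inWindow k u p is the indicator of u ≤ p < u + k.
inWindow : ℕ → ℕ → ℕ → ℕ
inWindow k zero    p       = 𝟙[ p < k ]
inWindow k (suc u) zero    = 0
inWindow k (suc u) (suc p) = inWindow k u p

inWindow-01 : ∀ k u p → Is01 (inWindow k u p)
inWindow-01 k zero    p       = 𝟙<-01 p k
inWindow-01 k (suc u) zero    = inj₁ refl
inWindow-01 k (suc u) (suc p) = inWindow-01 k u p

inWindow-sound : ∀ k u p → inWindow k u p ≡ 1 → u ≤ p × p < u + k
inWindow-sound k zero    p       e = z≤n , 𝟙<-sound p k e
inWindow-sound k (suc u) (suc p) e with inWindow-sound k u p e
... | u≤p , p<u+k = s≤s u≤p , s≤s p<u+k

∑-𝟙[p<k] : ∀ U k → ∑ (upTo U) (λ p → 𝟙[ p < k ]) ≤ k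
∑-𝟙[p<k] zero    k       = z≤n
∑-𝟙[p<k] (suc U) zero    = ≤-reflexive (∑-zero (upTo (suc U)))
∑-𝟙[p<k] (suc U) (suc k) = begin
  ∑ (upTo (suc U)) (λ p → 𝟙[ p < suc k ]) ≡⟨ ∑-upTo-suc U (λ p → 𝟙[ p < suc k ]) ⟩
  1 + ∑ (upTo U) (λ p → 𝟙[ p < k ])       ≤⟨ s≤s (∑-𝟙[p<k] U k) ⟩
  suc k                                   ∎
  where open ≤-Reasoning

∑-𝟙[p<k]-exact : ∀ U k → k ≤ U → ∑ (upTo U) (λ p → 𝟙[ p < k ]) ≡ k
∑-𝟙[p<k]-exact U       zero    _         = ∑-zero (upTo U)
∑-𝟙[p<k]-exact (suc U) (suc k) (s≤s k≤U) =
  trans (∑-upTo-suc U (λ p → 𝟙[ p < suc k ])) (cong suc (∑-𝟙[p<k]-exact U k k≤U))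

∑-inWindow : ∀ U k u → u + k ≤ U → ∑ (upTo U) (inWindow k u) ≡ k
∑-inWindow U       k zero    k≤U = ∑-𝟙[p<k]-exact U k k≤U
∑-inWindow (suc U) k (suc u) (s≤s u+k≤U) =
  trans (∑-upTo-suc U (inWindow k (suc u))) (∑-inWindow U k u u+k≤U)

∑-𝟙[p<k]*inWindow : ∀ U k l v → ∑ (upTo U) (λ p → 𝟙[ p < k ] * inWindow l v p) ≤ k ∸ v
∑-𝟙[p<k]*inWindow U k l zero = ≤-trans
  (∑-mono (upTo U) (λ p → *-≤1ʳ 𝟙[ p < k ] (01⇒≤1 (inWindow-01 l zero p))))
  (∑-𝟙[p<k] U k)
∑-𝟙[p<k]*inWindow zero    k       l (suc v) = z≤n
∑-𝟙[p<k]*inWindow (suc U) zero    l (suc v) = ≤-reflexive (∑-zero (upTo (suc U)))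
∑-𝟙[p<k]*inWindow (suc U) (suc k) l (suc v) = ≤-trans
  (≤-reflexive (∑-upTo-suc U (λ p → 𝟙[ p < suc k ] * inWindow l (suc v) p)))
  (∑-𝟙[p<k]*inWindow U k l v)

∑-inWindow-overlap : ∀ U k u v → ∑ (upTo U) (λ p → inWindow k u p * inWindow k v p) ≤ k ∸ ∣ u - v ∣
∑-inWindow-overlap U       k zero    v       = ∑-𝟙[p<k]*inWindow U k k v
∑-inWindow-overlap U       k (suc u) zero    = ≤-trans
  (≤-reflexive (∑-cong (upTo U) (λ p → *-comm (inWindow k (suc u) p) 𝟙[ p < k ])))
  (∑-𝟙[p<k]*inWindow U k k (suc u))
∑-inWindow-overlap zero    k (suc u) (suc v) = z≤n
∑-inWindow-overlap (suc U) k (suc u) (suc v) = ≤-trans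
  (≤-reflexive (∑-upTo-suc U (λ p → inWindow k (suc u) p * inWindow k (suc v) p)))
  (∑-inWindow-overlap U k u v)

∑[k∸suc+k∸]≡k*k : ∀ k → ∑ (upTo k) (λ i → (k ∸ suc i) + (k ∸ i)) ≡ k * k
∑[k∸suc+k∸]≡k*k zero    = refl
∑[k∸suc+k∸]≡k*k (suc k) = begin
  ∑ (upTo (suc k)) (λ i → (suc k ∸ suc i) + (suc k ∸ i)) ≡⟨ ∑-upTo-suc k _ ⟩
  k + suc k + ∑ (upTo k) (λ i → (k ∸ suc i) + (k ∸ i))   ≡⟨ cong (k + suc k +_) (∑[k∸suc+k∸]≡k*k k) ⟩
  k + suc k + k * k                                       ≡⟨ solve (k ∷ []) ⟩
  suc k * suc k                                           ∎
  where open ≡-Reasoning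

∑-tent-split : ∀ k n c →
  ∑ (upTo n) (λ u → k ∸ ∣ u - c ∣) ≤ ∑ (upTo c) (λ i → k ∸ suc i) + ∑ (upTo n) (λ u → k ∸ u)
∑-tent-split k n       zero    = ≤-reflexive (∑-cong (upTo n) (λ u → cong (k ∸_) (∣-∣-identityʳ u)))
∑-tent-split k zero    (suc c) = z≤n
∑-tent-split k (suc n) (suc c) = begin
  ∑ (upTo (suc n)) (λ u → k ∸ ∣ u - suc c ∣)     ≡⟨ ∑-upTo-suc n (λ u → k ∸ ∣ u - suc c ∣) ⟩
  (k ∸ suc c) + ∑ (upTo n) (λ u → k ∸ ∣ u - c ∣) ≤⟨ +-monoʳ-≤ (k ∸ suc c) (∑-tent-split k n c) ⟩
  (k ∸ suc c) + (L + R)                          ≡⟨ regroup (k ∸ suc c) L R ⟩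
  (L + (k ∸ suc c)) + R                          ≤⟨ +-monoʳ-≤ (L + (k ∸ suc c)) (m≤n+m R (k ∸ n)) ⟩
  (L + (k ∸ suc c)) + ((k ∸ n) + R)              ≡⟨ cong₂ _+_ (sym (∑-upTo-∷ʳ c (λ i → k ∸ suc i)))
                                                      (trans (+-comm (k ∸ n) R) (sym (∑-upTo-∷ʳ n (k ∸_)))) ⟩
  ∑ (upTo (suc c)) (λ i → k ∸ suc i) + ∑ (upTo (suc n)) (λ u → k ∸ u) ∎
  where
  open ≤-Reasoning
  L = ∑ (upTo c) (λ i → k ∸ suc i)
  R = ∑ (upTo n) (λ u → k ∸ u)
  regroup : ∀ a b c → a + (b + c) ≡ (b + a) + c
  regroup = solve-∀

∑-tent≤k*k : ∀ k n c → ∑ (upTo n) (λ u → k ∸ ∣ u - c ∣) ≤ k * k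
∑-tent≤k*k k n c = begin
  ∑ (upTo n) (λ u → k ∸ ∣ u - c ∣)                                  ≤⟨ ∑-tent-split k n c ⟩
  ∑ (upTo c) (λ i → k ∸ suc i) + ∑ (upTo n) (λ u → k ∸ u)           ≤⟨ +-mono-≤
    (∑-upTo-≤-support c k (λ i → k ∸ suc i) (λ i k≤i → m≤n⇒m∸n≡0 (m≤n⇒m≤1+n k≤i)))
    (∑-upTo-≤-support n k (k ∸_) (λ i k≤i → m≤n⇒m∸n≡0 k≤i)) ⟩
  ∑ (upTo k) (λ i → k ∸ suc i) + ∑ (upTo k) (λ u → k ∸ u)           ≡⟨ sym (∑-distrib-+ (upTo k) _ _) ⟩
  ∑ (upTo k) (λ i → (k ∸ suc i) + (k ∸ i))                          ≡⟨ ∑[k∸suc+k∸]≡k*k k ⟩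
  k * k                                                             ∎
  where open ≤-Reasoning

∣x+m∸y-m∣≡∣x-y∣ : ∀ x y m → y ≤ m → ∣ x + m ∸ y - m ∣ ≡ ∣ x - y ∣
∣x+m∸y-m∣≡∣x-y∣ x y m y≤m = begin
  ∣ x + m ∸ y - m ∣               ≡⟨ cong₂ ∣_-_∣ (+-∸-assoc x y≤m) (sym (m∸n+n≡m y≤m)) ⟩
  ∣ x + (m ∸ y) - (m ∸ y) + y ∣   ≡⟨ cong (λ z → ∣ z - (m ∸ y) + y ∣) (+-comm x (m ∸ y)) ⟩
  ∣ (m ∸ y) + x - (m ∸ y) + y ∣   ≡⟨ ∣m+n-m+o∣≡∣n-o∣ (m ∸ y) x y ⟩
  ∣ x - y ∣                       ∎
  where open ≡-Reasoning

∑-𝟙[p<q] : ∀ U p → ∑ (upTo U) (λ q → 𝟙[ p < q ]) ≤ U ∸ suc p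
∑-𝟙[p<q] zero    p       = z≤n
∑-𝟙[p<q] (suc U) zero    = ≤-reflexive (begin
  ∑ (upTo (suc U)) (λ q → 𝟙[ 0 < q ]) ≡⟨ ∑-upTo-suc U (λ q → 𝟙[ 0 < q ]) ⟩
  ∑ (upTo U) (λ _ → 1)                ≡⟨ ∑-const (upTo U) 1 ⟩
  length (upTo U) * 1                 ≡⟨ *-identityʳ _ ⟩
  length (upTo U)                     ≡⟨ length-upTo U ⟩
  U                                   ∎)
  where open ≡-Reasoning
∑-𝟙[p<q] (suc U) (suc p) = ≤-trans (≤-reflexive (∑-upTo-suc U (λ q → 𝟙[ suc p < q ]))) (∑-𝟙[p<q] U p)

∑-𝟙[p<s+q] : ∀ U p s → ∑ (upTo U) (λ q → 𝟙[ p < s + q ]) ≤ U + s ∸ suc p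
∑-𝟙[p<s+q] U p       zero    = subst (λ z → ∑ (upTo U) (λ q → 𝟙[ p < q ]) ≤ z ∸ suc p)
  (sym (+-identityʳ U)) (∑-𝟙[p<q] U p)
∑-𝟙[p<s+q] U zero    (suc s) = begin
  ∑ (upTo U) (λ _ → 1) ≡⟨ ∑-const (upTo U) 1 ⟩
  length (upTo U) * 1  ≡⟨ trans (*-identityʳ _) (length-upTo U) ⟩
  U                    ≤⟨ m≤m+n U s ⟩
  U + s                ≡⟨ cong (_∸ 1) (sym (+-suc U s)) ⟩
  U + suc s ∸ 1        ∎
  where open ≤-Reasoning
∑-𝟙[p<s+q] U (suc p) (suc s) = subst (λ z → ∑ (upTo U) (λ q → 𝟙[ p < s + q ]) ≤ z ∸ suc (suc p))
  (sym (+-suc U s)) (∑-𝟙[p<s+q] U p s)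

∑-𝟙[c+q<r] : ∀ U c r → ∑ (upTo U) (λ q → 𝟙[ c + q < r ]) ≤ r ∸ c
∑-𝟙[c+q<r] U zero    r       = ∑-𝟙[p<k] U r
∑-𝟙[c+q<r] U (suc c) zero    = ≤-reflexive (∑-zero (upTo U))
∑-𝟙[c+q<r] U (suc c) (suc r) = ∑-𝟙[c+q<r] U c r

2*suc≤∣c-2lo∣+∣c-2[lo+suc]∣ : ∀ U c lo → 2 * suc U ≤ ∣ c - 2 * (lo + 0) ∣ + ∣ c - 2 * (lo + suc U) ∣
2*suc≤∣c-2lo∣+∣c-2[lo+suc]∣ U c lo = begin
  2 * suc U                                           ≡⟨ sym (∣m-m+n∣≡n (2 * (lo + 0)) (2 * suc U)) ⟩
  ∣ 2 * (lo + 0) - 2 * (lo + 0) + 2 * suc U ∣         ≡⟨ cong (λ z → ∣ 2 * (lo + 0) - z ∣) (solve (U ∷ lo ∷ [])) ⟩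
  ∣ 2 * (lo + 0) - 2 * (lo + suc U) ∣                 ≤⟨ ∣-∣-triangle (2 * (lo + 0)) c (2 * (lo + suc U)) ⟩
  ∣ 2 * (lo + 0) - c ∣ + ∣ c - 2 * (lo + suc U) ∣     ≡⟨ cong (_+ ∣ c - 2 * (lo + suc U) ∣) (∣-∣-comm (2 * (lo + 0)) c) ⟩
  ∣ c - 2 * (lo + 0) ∣ + ∣ c - 2 * (lo + suc U) ∣     ∎
  where open ≤-Reasoning

U*U≤2*∑∣c-2p∣+1 : ∀ U c lo → U * U ≤ 2 * ∑ (upTo U) (λ p → ∣ c - 2 * (lo + p) ∣) + 1
U*U≤2*∑∣c-2p∣+1 zero          c lo = z≤n
U*U≤2*∑∣c-2p∣+1 (suc zero)    c lo = m≤n+m 1 _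
U*U≤2*∑∣c-2p∣+1 (suc (suc U)) c lo = begin
  suc (suc U) * suc (suc U)                    ≡⟨ solve (U ∷ []) ⟩
  U * U + 2 * (2 * suc U)                      ≤⟨ +-mono-≤ (U*U≤2*∑∣c-2p∣+1 U c (suc lo))
                                                           (*-monoʳ-≤ 2 (2*suc≤∣c-2lo∣+∣c-2[lo+suc]∣ U c lo)) ⟩
  (2 * inner + 1) + 2 * (f 0 + f (suc U))      ≡⟨ regroup inner (f 0) (f (suc U)) ⟩
  2 * (f 0 + (inner + f (suc U))) + 1          ≡⟨ cong (λ z → 2 * z + 1) (sym split) ⟩
  2 * ∑ (upTo (suc (suc U))) f + 1             ∎
  where
  open ≤-Reasoning
  f : ℕ → ℕ
  f p = ∣ c - 2 * (lo + p) ∣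
  inner : ℕ
  inner = ∑ (upTo U) (λ p → ∣ c - 2 * (suc lo + p) ∣)
  regroup : ∀ i a b → (2 * i + 1) + 2 * (a + b) ≡ 2 * (a + (i + b)) + 1
  regroup = solve-∀
  split : ∑ (upTo (suc (suc U))) f ≡ f 0 + (inner + f (suc U))
  split = trans (∑-upTo-suc (suc U) f) (cong (f 0 +_) (trans (∑-upTo-∷ʳ U (f ∘ suc))
    (cong (_+ f (suc U)) (∑-cong (upTo U) (λ p → cong (λ z → ∣ c - 2 * z ∣) (+-suc lo p))))))

2*c+[b∸a]≤a+b : ∀ {c a b} → c ≤ a → a ≤ b → 2 * c + (b ∸ a) ≤ a + b
2*c+[b∸a]≤a+b {c} {a} {b} c≤a a≤b = begin
  2 * c + (b ∸ a)     ≤⟨ +-monoˡ-≤ (b ∸ a) (*-monoʳ-≤ 2 c≤a) ⟩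
  2 * a + (b ∸ a)     ≡⟨ cong (_+ (b ∸ a)) (cong (a +_) (+-identityʳ a)) ⟩
  a + a + (b ∸ a)     ≡⟨ +-assoc a a (b ∸ a) ⟩
  a + (a + (b ∸ a))   ≡⟨ cong (a +_) (m+[n∸m]≡n a≤b) ⟩
  a + b               ∎
  where open ≤-Reasoning

2*c+∣a-b∣≤a+b : ∀ {c a b} → c ≤ a → c ≤ b → 2 * c + ∣ a - b ∣ ≤ a + b
2*c+∣a-b∣≤a+b {c} {a} {b} c≤a c≤b with ≤-total a b
... | inj₁ a≤b = subst (λ z → 2 * c + z ≤ a + b) (sym (m≤n⇒∣m-n∣≡n∸m a≤b)) (2*c+[b∸a]≤a+b c≤a a≤b)
... | inj₂ b≤a = subst₂ (λ z w → 2 * c + z ≤ w) (sym (m≤n⇒∣n-m∣≡n∸m b≤a)) (+-comm b a)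
  (2*c+[b∸a]≤a+b c≤b b≤a)

-- The indicator that the k × k window with corner (p, q) meets the strip X ≤ Y + K < X + m.
admissible : (m k K p q : ℕ) → ℕ
admissible m k K p q = 𝟙[ p < K + k + q ] * 𝟙[ suc K + q < p + m + k ]

admissible-01 : ∀ m k K p q → Is01 (admissible m k K p q)
admissible-01 m k K p q = 01-* (𝟙<-01 p (K + k + q)) (𝟙<-01 (suc K + q) (p + m + k))

-- A and B bound a count n through the two constraints separately; A + B does not depend
-- on p and A − B = c − 2p, so 2n ≤ 2 min(A, B) = 2m + 3k' − ∣c − 2p∣.
row-count-arith : ∀ m k' K p {n A B} → n ≤ A → n ≤ B →
  A + suc p ≡ (m + k') + (K + suc k') → B + suc K ≡ p + m + suc k' →
  2 * n + ∣ (2 * K + k') - 2 * p ∣ ≤ 2 * m + 3 * k'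
row-count-arith m k' K p {n} {A} {B} n≤A n≤B eqA eqB =
  subst₂ (λ x y → 2 * n + x ≤ y) ∣A-B∣≡∣c-2p∣ A+B≡ (2*c+∣a-b∣≤a+b n≤A n≤B)
  where
  open ≡-Reasoning
  c = 2 * K + k'
  A+B≡ : A + B ≡ 2 * m + 3 * k'
  A+B≡ = +-cancelʳ-≡ (suc p + suc K) _ _ (begin
    A + B + (suc p + suc K)                    ≡⟨ solve (A ∷ B ∷ p ∷ K ∷ []) ⟩
    (A + suc p) + (B + suc K)                  ≡⟨ cong₂ _+_ eqA eqB ⟩
    (m + k') + (K + suc k') + (p + m + suc k') ≡⟨ solve (m ∷ k' ∷ K ∷ p ∷ []) ⟩
    2 * m + 3 * k' + (suc p + suc K)           ∎)
  A+2p≡B+c : A + 2 * p ≡ B + c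
  A+2p≡B+c = +-cancelʳ-≡ (suc p + suc K) _ _ (begin
    A + 2 * p + (suc p + suc K)               ≡⟨ solve (A ∷ p ∷ K ∷ []) ⟩
    (A + suc p) + (2 * p + suc K)             ≡⟨ cong (_+ (2 * p + suc K)) eqA ⟩
    (m + k') + (K + suc k') + (2 * p + suc K) ≡⟨ solve (m ∷ k' ∷ K ∷ p ∷ []) ⟩
    (p + m + suc k') + ((2 * K + k') + suc p) ≡⟨ cong (_+ (c + suc p)) (sym eqB) ⟩
    (B + suc K) + ((2 * K + k') + suc p)      ≡⟨ solve (B ∷ K ∷ k' ∷ p ∷ []) ⟩
    B + (2 * K + k') + (suc p + suc K)        ∎)
  ∣A-B∣≡∣c-2p∣ : ∣ A - B ∣ ≡ ∣ c - 2 * p ∣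
  ∣A-B∣≡∣c-2p∣ = begin
    ∣ A - B ∣                 ≡⟨ sym (∣m+n-m+o∣≡∣n-o∣ (2 * p) A B) ⟩
    ∣ 2 * p + A - 2 * p + B ∣ ≡⟨ cong₂ ∣_-_∣ (trans (+-comm (2 * p) A) A+2p≡B+c) (+-comm (2 * p) B) ⟩
    ∣ B + c - B + 2 * p ∣     ≡⟨ ∣m+n-m+o∣≡∣n-o∣ B c (2 * p) ⟩
    ∣ c - 2 * p ∣             ∎

∑-admissible-row : ∀ m k' K p → K < m → p < m + k' →
  2 * ∑ (upTo (m + k')) (admissible m (suc k') K p) + ∣ (2 * K + k') - 2 * p ∣ ≤ 2 * m + 3 * k'
∑-admissible-row m k' K p K<m p<U = row-count-arith m k' K p n≤A n≤B
  (m∸n+n≡m (≤-trans p<U (m≤m+n U s)))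
  (m∸n+n≡m (≤-trans K<m (≤-trans (m≤n+m m p) (m≤m+n (p + m) (suc k')))))
  where
  U = m + k'
  s = K + suc k'
  n≤A : ∑ (upTo U) (admissible m (suc k') K p) ≤ U + s ∸ suc p
  n≤A = ≤-trans (∑-mono (upTo U) (λ q → *-≤1ʳ _ (01⇒≤1 (𝟙<-01 (suc K + q) (p + m + suc k')))))
                (∑-𝟙[p<s+q] U p s)
  n≤B : ∑ (upTo U) (admissible m (suc k') K p) ≤ p + m + suc k' ∸ suc K
  n≤B = ≤-trans (∑-mono (upTo U) (λ q → *-≤1ˡ _ (01⇒≤1 (𝟙<-01 p (s + q)))))
                (∑-𝟙[c+q<r] U (suc K) (p + m + suc k'))

admissibleCount : (m k' K : ℕ) → ℕ
admissibleCount m k' K = ∑ (upTo (m + k')) (λ p → ∑ (upTo (m + k')) (admissible m (suc k') K p))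

-- Sum the bound of ∑-admissible-row over p and bound ∑ ∣c − 2p∣ from below.
admissibleCount-bound : ∀ m k' K → K < m →
  4 * admissibleCount m k' K + (m + k') * (m + k') ≤ 2 * ((m + k') * (2 * m + 3 * k')) + 1
admissibleCount-bound m k' K K<m = begin
  4 * T + U * U               ≤⟨ +-monoʳ-≤ (4 * T) (U*U≤2*∑∣c-2p∣+1 U c 0) ⟩
  4 * T + (2 * D + 1)         ≡⟨ regroup T D ⟩
  2 * (2 * T + D) + 1         ≤⟨ +-monoˡ-≤ 1 (*-monoʳ-≤ 2 rows) ⟩
  2 * (U * W) + 1             ∎
  where
  open ≤-Reasoning
  U = m + k'
  W = 2 * m + 3 * k'
  c = 2 * K + k'
  rowCount : ℕ → ℕ
  rowCount p = ∑ (upTo U) (admissible m (suc k') K p)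
  T = admissibleCount m k' K
  D = ∑ (upTo U) (λ p → ∣ c - 2 * (0 + p) ∣)
  regroup : ∀ t d → 4 * t + (2 * d + 1) ≡ 2 * (2 * t + d) + 1
  regroup = solve-∀
  rows : 2 * T + D ≤ U * W
  rows = begin
    2 * T + D                                         ≡⟨ cong (_+ D) (sym (∑-*ˡ (upTo U) 2 rowCount)) ⟩
    ∑ (upTo U) (λ p → 2 * rowCount p) + D             ≡⟨ sym (∑-distrib-+ (upTo U) _ (λ p → ∣ c - 2 * p ∣)) ⟩
    ∑ (upTo U) (λ p → 2 * rowCount p + ∣ c - 2 * p ∣) ≤⟨ ∑-mono-∈ (upTo U) (λ p p∈ → ∑-admissible-row m k' K p K<m (∈-upTo⁻ p∈)) ⟩
    ∑ (upTo U) (λ _ → W)                              ≡⟨ ∑-const (upTo U) W ⟩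
    length (upTo U) * W                               ≡⟨ cong (_* W) (length-upTo U) ⟩
    U * W                                             ∎

-- A honeycomb array translated so that its dots (X a, Y a) lie in [0, m)²; the
-- difference vectors are shifted by m so that they stay in ℕ.
record NormalisedHoneycomb (m : ℕ) : Set where
  field
    X Y     : Fin m → ℕ
    X<m     : ∀ a → X a < m
    Y<m     : ∀ a → Y a < m
    K       : ℕ
    K<m     : K < m
    X≤Y+K   : ∀ a → X a ≤ Y a + K
    Y+K<X+m : ∀ a → Y a + K < X a + m
    distinct-differences : ∀ {a b a' b'} → a ≢ b → a' ≢ b' →
      X a + m ∸ X b ≡ X a' + m ∸ X b' → Y a + m ∸ Y b ≡ Y a' + m ∸ Y b' → a ≡ a' × b ≡ b'

-- The windows are the k × k squares [p, p + k) × [q, q + k) with p, q < m + k'; every dot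
-- lies in exactly k² of them.
module WindowArgument {m} (H : NormalisedHoneycomb m) (k' : ℕ) where

  open NormalisedHoneycomb H

  k = suc k'
  U = m + k'

  windows : List (ℕ × ℕ)
  windows = cartesianProduct (upTo U) (upTo U)

  dotIn : Fin m → ℕ → ℕ → ℕ
  dotIn a p q = inWindow k (X a) p * inWindow k (Y a) q

  load : ℕ → ℕ → ℕ
  load p q = ∑ (allFin m) (λ a → dotIn a p q)

  isAdmissible : ℕ → ℕ → ℕ
  isAdmissible = admissible m k K

  dotIn-01 : ∀ a p q → Is01 (dotIn a p q)
  dotIn-01 a p q = 01-* (inWindow-01 k (X a) p) (inWindow-01 k (Y a) q)

  dotIn⇒admissible : ∀ a p q → inWindow k (X a) p ≡ 1 → inWindow k (Y a) q ≡ 1 → isAdmissible p q ≡ 1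
  dotIn⇒admissible a p q inX inY = cong₂ _*_ (𝟙<-complete p<K+k+q) (𝟙<-complete 1+K+q<p+m+k)
    where
    open ≤-Reasoning
    x = X a
    y = Y a
    x≤p = proj₁ (inWindow-sound k x p inX)
    p<x+k = proj₂ (inWindow-sound k x p inX)
    y≤q = proj₁ (inWindow-sound k y q inY)
    q<y+k = proj₂ (inWindow-sound k y q inY)
    p<K+k+q : p < K + k + q
    p<K+k+q = begin-strict
      p         <⟨ p<x+k ⟩
      x + k     ≤⟨ +-monoˡ-≤ k (X≤Y+K a) ⟩
      y + K + k ≤⟨ +-monoˡ-≤ k (+-monoˡ-≤ K y≤q) ⟩
      q + K + k ≡⟨ rotate q K k ⟩
      K + k + q ∎
      where
      rotate : ∀ q K k → q + K + k ≡ K + k + q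
      rotate = solve-∀
    1+K+q<p+m+k : suc K + q < p + m + k
    1+K+q<p+m+k = begin-strict
      suc K + q         ≡⟨ sym (+-suc K q) ⟩
      K + suc q         <⟨ +-monoʳ-< K (s≤s q<y+k) ⟩
      K + suc (y + k)   ≡⟨ shuffle K y k ⟩
      suc (y + K) + k   ≤⟨ +-monoˡ-≤ k (Y+K<X+m a) ⟩
      x + m + k         ≤⟨ +-monoˡ-≤ k (+-monoˡ-≤ m x≤p) ⟩
      p + m + k         ∎
      where
      shuffle : ∀ K y k → K + suc (y + k) ≡ suc (y + K) + k
      shuffle = solve-∀

  admissible-dotIn : ∀ a p q → isAdmissible p q * dotIn a p q ≡ dotIn a p q
  admissible-dotIn a p q = 01-*-support (dotIn-01 a p q) (λ e →
    dotIn⇒admissible a p q (m*n≡1⇒m≡1 x y e) (m*n≡1⇒n≡1 x y e))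
    where
    x = inWindow k (X a) p
    y = inWindow k (Y a) q

  ∑-dotIn : ∀ a → ∑ windows (uncurry (dotIn a)) ≡ k * k
  ∑-dotIn a = begin
    ∑ windows (uncurry (dotIn a))                                            ≡⟨ ∑-cartesianProduct (upTo U) (upTo U) _ ⟩
    ∑ (upTo U) (λ p → ∑ (upTo U) (λ q → inWindow k (X a) p * inWindow k (Y a) q)) ≡⟨ sym (∑*∑ (upTo U) (upTo U) _ _) ⟩
    ∑ (upTo U) (inWindow k (X a)) * ∑ (upTo U) (inWindow k (Y a))            ≡⟨ cong₂ _*_ (∑-inWindow U k (X a) (fits (X<m a)))
                                                                                              (∑-inWindow U k (Y a) (fits (Y<m a))) ⟩
    k * k                                                                    ∎
    where
    open ≡-Reasoning
    fits : ∀ {x} → x < m → x + k ≤ U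
    fits {x} x<m = subst (_≤ U) (sym (+-suc x k')) (+-monoˡ-≤ k' x<m)

  ∑-admissible*load : ∑ windows (λ (p , q) → isAdmissible p q * load p q) ≡ m * (k * k)
  ∑-admissible*load = begin
    ∑ windows (λ (p , q) → isAdmissible p q * load p q)                     ≡⟨ ∑-cong windows (λ (p , q) →
                                                                                  sym (∑-*ˡ (allFin m) (isAdmissible p q) (λ a → dotIn a p q))) ⟩
    ∑ windows (λ (p , q) → ∑ (allFin m) (λ a → isAdmissible p q * dotIn a p q)) ≡⟨ ∑-cong windows (λ (p , q) →
                                                                                  ∑-cong (allFin m) (λ a → admissible-dotIn a p q)) ⟩
    ∑ windows (λ (p , q) → load p q)                                        ≡⟨ ∑-comm windows (allFin m) (λ (p , q) a → dotIn a p q) ⟩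
    ∑ (allFin m) (λ a → ∑ windows (uncurry (dotIn a)))                     ≡⟨ ∑-cong (allFin m) ∑-dotIn ⟩
    ∑ (allFin m) (λ _ → k * k)                                              ≡⟨ ∑-const (allFin m) (k * k) ⟩
    length (allFin m) * (k * k)                                             ≡⟨ cong (_* (k * k)) (length-allFin m) ⟩
    m * (k * k)                                                             ∎
    where open ≡-Reasoning

  ∑-admissible² : ∑ windows (λ (p , q) → isAdmissible p q * isAdmissible p q) ≡ admissibleCount m k' K
  ∑-admissible² = trans (∑-cartesianProduct (upTo U) (upTo U) _)
    (∑-cong (upTo U) (λ p → ∑-cong (upTo U) (λ q → 01⇒*-idem (admissible-01 m k K p q))))

  sharedWindows : Fin m → Fin m → ℕ
  sharedWindows a b = (k ∸ ∣ X a - X b ∣) * (k ∸ ∣ Y a - Y b ∣)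

  ∑-dotIn*dotIn : ∀ a b → ∑ windows (λ (p , q) → dotIn a p q * dotIn b p q) ≤ sharedWindows a b
  ∑-dotIn*dotIn a b = begin
    ∑ windows (λ (p , q) → dotIn a p q * dotIn b p q)                   ≡⟨ ∑-cartesianProduct (upTo U) (upTo U) _ ⟩
    ∑ (upTo U) (λ p → ∑ (upTo U) (λ q → dotIn a p q * dotIn b p q))     ≡⟨ ∑-cong (upTo U) (λ p → ∑-cong (upTo U) (λ q →
                                                                             interchange (x a p) (y a q) (x b p) (y b q))) ⟩
    ∑ (upTo U) (λ p → ∑ (upTo U) (λ q → (x a p * x b p) * (y a q * y b q))) ≡⟨ sym (∑*∑ (upTo U) (upTo U) _ _) ⟩
    ∑ (upTo U) (λ p → x a p * x b p) * ∑ (upTo U) (λ q → y a q * y b q) ≤⟨ *-mono-≤ (∑-inWindow-overlap U k (X a) (X b))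
                                                                                    (∑-inWindow-overlap U k (Y a) (Y b)) ⟩
    sharedWindows a b                                                         ∎
    where
    open ≤-Reasoning
    x y : Fin m → ℕ → ℕ
    x a = inWindow k (X a)
    y a = inWindow k (Y a)
    interchange : ∀ a b c d → a * b * (c * d) ≡ (a * c) * (b * d)
    interchange = solve-∀

  pairs : List (Fin m × Fin m)
  pairs = cartesianProduct (allFin m) (allFin m)

  difference : Fin m × Fin m → ℕ × ℕ
  difference (a , b) = (X a + m ∸ X b , Y a + m ∸ Y b)

  differenceBox : List (ℕ × ℕ)
  differenceBox = cartesianProduct (upTo (m + m)) (upTo (m + m))

  tent : ℕ × ℕ → ℕ
  tent (u , v) = (k ∸ ∣ u - m ∣) * (k ∸ ∣ v - m ∣)

  -- Distinct differences make a ↦ difference a injective off the diagonal, so the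
  -- off-diagonal overlaps sum to at most the total mass of the tent.
  ∑-offDiagonal-overlap : ∑ pairs (λ (a , b) → offDiagonal a b (sharedWindows a b)) ≤ (k * k) * (k * k)
  ∑-offDiagonal-overlap = begin
    ∑ pairs (λ (a , b) → offDiagonal a b (sharedWindows a b)) ≤⟨ ∑-≤-injection pairs difference (λ (a , b) → a ≢ b)
                                                               (cartesianProduct⁺ (allFin⁺ m) (allFin⁺ m))
                                                               sharedWindows-cases difference-injective difference∈box ⟩
    ∑ differenceBox tent                               ≡⟨ ∑-cartesianProduct (upTo (m + m)) (upTo (m + m)) tent ⟩
    ∑ (upTo (m + m)) (λ u → ∑ (upTo (m + m)) (λ v → (k ∸ ∣ u - m ∣) * (k ∸ ∣ v - m ∣))) ≡⟨ sym (∑*∑ (upTo (m + m)) (upTo (m + m)) _ _) ⟩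
    ∑ (upTo (m + m)) (λ u → k ∸ ∣ u - m ∣) * ∑ (upTo (m + m)) (λ v → k ∸ ∣ v - m ∣)
                                                       ≤⟨ *-mono-≤ (∑-tent≤k*k k (m + m) m) (∑-tent≤k*k k (m + m) m) ⟩
    (k * k) * (k * k)                                  ∎
    where
    open ≤-Reasoning
    sharedWindows-cases : ∀ ((a , b) : Fin m × Fin m) →
      offDiagonal a b (sharedWindows a b) ≡ 0 ⊎ (a ≢ b × offDiagonal a b (sharedWindows a b) ≡ tent (difference (a , b)))
    sharedWindows-cases (a , b) with offDiagonal-cases a b (sharedWindows a b)
    ... | inj₁ e          = inj₁ e
    ... | inj₂ (a≢b , e) = inj₂ (a≢b , trans e (sym (cong₂ _*_
            (cong (k ∸_) (∣x+m∸y-m∣≡∣x-y∣ (X a) (X b) m (<⇒≤ (X<m b))))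
            (cong (k ∸_) (∣x+m∸y-m∣≡∣x-y∣ (Y a) (Y b) m (<⇒≤ (Y<m b)))))))
    difference-injective : ∀ {(a , b) (a' , b') : Fin m × Fin m} → a ≢ b → a' ≢ b' →
      difference (a , b) ≡ difference (a' , b') → (a , b) ≡ (a' , b')
    difference-injective a≢b a'≢b' e with distinct-differences a≢b a'≢b' (cong proj₁ e) (cong proj₂ e)
    ... | refl , refl = refl
    shifted<2m : ∀ {x} y → x < m → x + m ∸ y < m + m
    shifted<2m {x} y x<m = ≤-<-trans (m∸n≤m (x + m) y) (+-monoˡ-< m x<m)
    difference∈box : ∀ {(a , b) : Fin m × Fin m} → (a , b) ∈ pairs → a ≢ b → difference (a , b) ∈ differenceBox
    difference∈box {a , b} _ _ = ∈-cartesianProduct⁺ (∈-upTo⁺ (shifted<2m (X b) (X<m a))) (∈-upTo⁺ (shifted<2m (Y b) (Y<m a)))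

  ∑-load² : ∑ windows (λ (p , q) → load p q * load p q) ≤ m * (k * k) + (k * k) * (k * k)
  ∑-load² = begin
    ∑ windows (λ (p , q) → load p q * load p q)                   ≡⟨ ∑-cong windows (λ (p , q) → ∑*∑ (allFin m) (allFin m) _ _) ⟩
    ∑ windows (λ t → ∑ (allFin m) (λ a → ∑ (allFin m) (λ b → both a b t)))
                                                                  ≡⟨ ∑-comm windows (allFin m) _ ⟩
    ∑ (allFin m) (λ a → ∑ windows (λ t → ∑ (allFin m) (λ b → both a b t)))
                                                                  ≡⟨ ∑-cong (allFin m) (λ a → ∑-comm windows (allFin m) _) ⟩
    ∑ (allFin m) (λ a → ∑ (allFin m) (λ b → ∑ windows (both a b))) ≤⟨ ∑-mono (allFin m) (λ a → ∑-mono (allFin m) (∑-dotIn*dotIn a)) ⟩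
    ∑ (allFin m) (λ a → ∑ (allFin m) (sharedWindows a))           ≡⟨ ∑-cong (allFin m) (λ a → ∑-split-diagonal m a (sharedWindows a)) ⟩
    ∑ (allFin m) (λ a → sharedWindows a a + ∑ (allFin m) (λ b → offDiagonal a b (sharedWindows a b)))
                                                                  ≡⟨ ∑-distrib-+ (allFin m) (λ a → sharedWindows a a) _ ⟩
    ∑ (allFin m) (λ a → sharedWindows a a) + ∑ (allFin m) (λ a → ∑ (allFin m) (λ b → offDiagonal a b (sharedWindows a b)))
                                                                  ≡⟨ cong₂ _+_ diagonal (sym (∑-cartesianProduct (allFin m) (allFin m) _)) ⟩
    m * (k * k) + ∑ pairs (λ (a , b) → offDiagonal a b (sharedWindows a b))
                                                                  ≤⟨ +-monoʳ-≤ (m * (k * k)) ∑-offDiagonal-overlap ⟩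
    m * (k * k) + (k * k) * (k * k)                               ∎
    where
    open ≤-Reasoning
    both : Fin m → Fin m → ℕ × ℕ → ℕ
    both a b (p , q) = dotIn a p q * dotIn b p q
    diagonal : ∑ (allFin m) (λ a → sharedWindows a a) ≡ m * (k * k)
    diagonal = begin-equality
      ∑ (allFin m) (λ a → sharedWindows a a) ≡⟨ ∑-cong (allFin m) (λ a →
                                                  cong₂ _*_ (cong (k ∸_) (∣n-n∣≡0 (X a))) (cong (k ∸_) (∣n-n∣≡0 (Y a)))) ⟩
      ∑ (allFin m) (λ _ → k * k)             ≡⟨ ∑-const (allFin m) (k * k) ⟩
      length (allFin m) * (k * k)            ≡⟨ cong (_* (k * k)) (length-allFin m) ⟩
      m * (k * k)                            ∎

  m²k²≤count*[m+k²] : m * m * (k * k) ≤ admissibleCount m k' K * (m + k * k)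
  m²k²≤count*[m+k²] = *-cancelʳ-≤ _ _ (k * k) (begin
    m * m * (k * k) * (k * k)                                 ≡⟨ square (k * k) ⟩
    (m * (k * k)) * (m * (k * k))                             ≡⟨ cong (λ z → z * z) (sym ∑-admissible*load) ⟩
    S * S                                                     ≤⟨ cauchy-schwarz windows (uncurry isAdmissible) (uncurry load) ⟩
    ∑ windows (λ (p , q) → isAdmissible p q * isAdmissible p q) * ∑ windows (λ (p , q) → load p q * load p q)
                                                              ≤⟨ *-mono-≤ (≤-reflexive ∑-admissible²) ∑-load² ⟩
    T * (m * (k * k) + (k * k) * (k * k))                     ≡⟨ factor T (k * k) ⟩
    T * (m + k * k) * (k * k)                                 ∎)
    where
    open ≤-Reasoning
    T = admissibleCount m k' K
    S = ∑ windows (λ (p , q) → isAdmissible p q * load p q)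
    square : ∀ κ → m * m * κ * κ ≡ (m * κ) * (m * κ)
    square κ = solve (m ∷ κ ∷ [])
    factor : ∀ t κ → t * (m * κ + κ * κ) ≡ t * (m + κ) * κ
    factor t κ = solve (t ∷ m ∷ κ ∷ [])

  window-bound : 4 * (m * m * (k * k)) + U * U * (m + k * k) ≤ (2 * (U * (2 * m + 3 * k')) + 1) * (m + k * k)
  window-bound = begin
    4 * (m * m * (k * k)) + U * U * (m + k * k) ≤⟨ +-monoˡ-≤ (U * U * (m + k * k)) (*-monoʳ-≤ 4 m²k²≤count*[m+k²]) ⟩
    4 * (T * (m + k * k)) + U * U * (m + k * k) ≡⟨ cong (_+ U * U * (m + k * k)) (sym (*-assoc 4 T (m + k * k))) ⟩
    4 * T * (m + k * k) + U * U * (m + k * k)   ≡⟨ sym (*-distribʳ-+ (m + k * k) (4 * T) (U * U)) ⟩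
    (4 * T + U * U) * (m + k * k)               ≤⟨ *-monoˡ-≤ (m + k * k) (admissibleCount-bound m k' K K<m) ⟩
    (2 * (U * (2 * m + 3 * k')) + 1) * (m + k * k) ∎
    where
    open ≤-Reasoning
    T = admissibleCount m k' K

offset : ℤ → ℤ → ℕ
offset c x = ℤ.∣ x ℤ.- c ∣

+offset : ∀ {c x} → c ℤ.≤ x → ℤ.+ offset c x ≡ x ℤ.- c
+offset c≤x = ℤ.0≤i⇒+∣i∣≡i (ℤ.i≤j⇒0≤j-i c≤x)

offset< : ∀ {c x m} → c ℤ.≤ x → x ℤ.< c ℤ.+ ℤ.+ m → offset c x < m
offset< {c} {x} {m} c≤x x<c+m = ℤ.drop‿+<+ (begin-strict
  ℤ.+ offset c x            ≡⟨ +offset c≤x ⟩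
  x ℤ.- c                 <⟨ ℤ.+-monoˡ-< (ℤ.- c) x<c+m ⟩
  c ℤ.+ ℤ.+ m ℤ.- c         ≡⟨ cancel c (ℤ.+ m) ⟩
  ℤ.+ m                     ∎)
  where
  open ℤ.≤-Reasoning
  cancel : ∀ c n → c ℤ.+ n ℤ.- c ≡ n
  cancel = ℤ.solve-∀

offset-at : ∀ {c x} n → x ≡ c ℤ.+ ℤ.+ n → offset c x ≡ n
offset-at {c} n refl = cong ℤ.∣_∣ (cancel c (ℤ.+ n))
  where
  cancel : ∀ c n → c ℤ.+ n ℤ.- c ≡ n
  cancel = ℤ.solve-∀

difference-via-offsets : ∀ {c x y} m → c ℤ.≤ x → c ℤ.≤ y → offset c y ≤ offset c x + m →
  x ℤ.- y ≡ ℤ.+ (offset c x + m ∸ offset c y) ℤ.- ℤ.+ m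
difference-via-offsets {c} {x} {y} m c≤x c≤y y≤x+m = begin
  x ℤ.- y                                ≡⟨ regroup x y c (ℤ.+ m) ⟩
  (x ℤ.- c ℤ.+ ℤ.+ m) ℤ.- (y ℤ.- c) ℤ.- ℤ.+ m ≡⟨ cong₂ (λ u v → u ℤ.+ ℤ.+ m ℤ.- v ℤ.- ℤ.+ m) (sym (+offset c≤x)) (sym (+offset c≤y)) ⟩
  (ℤ.+ (offset c x + m)) ℤ.- ℤ.+ offset c y ℤ.- ℤ.+ m ≡⟨ cong (ℤ._- ℤ.+ m) (trans (ℤ.m-n≡m⊖n (offset c x + m) (offset c y)) (ℤ.⊖-≥ y≤x+m)) ⟩
  ℤ.+ (offset c x + m ∸ offset c y) ℤ.- ℤ.+ m ∎
  where
  open ≡-Reasoning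
  regroup : ∀ x y c m → x ℤ.- y ≡ (x ℤ.- c ℤ.+ m) ℤ.- (y ℤ.- c) ℤ.- m
  regroup = ℤ.solve-∀

normalise : ∀ {m} {d : Config (suc m)} → IsHoneycombArray d → NormalisedHoneycomb (suc m)
normalise {m} {d} (_ , ddc , ((c , colIn , colHit) , (c' , rowIn , rowHit)) , (e , diagIn)) = record
  { X = X ; Y = Y ; X<m = X<m ; Y<m = Y<m ; K = K ; K<m = K<m
  ; X≤Y+K = λ a → subst (X a ≤_) (sym (Y+K≡X+Z a)) (m≤m+n (X a) (Z a))
  ; Y+K<X+m = λ a → subst (_< X a + suc m) (sym (Y+K≡X+Z a)) (+-monoʳ-< (X a) (Z<m a))
  ; distinct-differences = λ a≢b a'≢b' eqX eqY → ddc _ _ _ _ a≢b a'≢b' (cong₂ _,_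
      (same-difference col colIn X<m eqX) (same-difference row rowIn Y<m eqY))
  }
  where
  X Y Z : Fin (suc m) → ℕ
  X t = offset c (col (d t))
  Y t = offset c' (row (d t))
  Z t = offset e (diag (d t))
  X<m Y<m Z<m : ∀ t → _ < suc m
  X<m t = offset< (proj₁ (colIn t)) (proj₂ (colIn t))
  Y<m t = offset< (proj₁ (rowIn t)) (proj₂ (rowIn t))
  Z<m t = offset< (proj₁ (diagIn t)) (proj₂ (diagIn t))
  δ = c' ℤ.- c ℤ.- e
  X+Z≡Y+δ : ∀ t → ℤ.+ (X t + Z t) ≡ ℤ.+ Y t ℤ.+ δ
  X+Z≡Y+δ t = begin
    ℤ.+ X t ℤ.+ ℤ.+ Z t                                      ≡⟨ cong₂ ℤ._+_ (+offset (proj₁ (colIn t)))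
                                                                              (+offset (proj₁ (diagIn t))) ⟩
    (col (d t) ℤ.- c) ℤ.+ ((row (d t) ℤ.- col (d t)) ℤ.- e) ≡⟨ regroup c c' e (col (d t)) (row (d t)) ⟩
    (row (d t) ℤ.- c') ℤ.+ δ                                 ≡⟨ cong (ℤ._+ δ) (sym (+offset (proj₁ (rowIn t)))) ⟩
    ℤ.+ Y t ℤ.+ δ                                            ∎
    where
    open ≡-Reasoning
    regroup : ∀ c c' e x y → (x ℤ.- c) ℤ.+ ((y ℤ.- x) ℤ.- e) ≡ (y ℤ.- c') ℤ.+ (c' ℤ.- c ℤ.- e)
    regroup = ℤ.solve-∀
  -- t₀ is the dot in the bottom row and t₁ the dot in the leftmost column; at t₀ the
  -- identity X + Z = Y + δ shows that δ is the natural number K.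
  t₀ = proj₁ (rowHit zero)
  t₁ = proj₁ (colHit zero)
  K = X t₀ + Z t₀
  δ≡K : δ ≡ ℤ.+ K
  δ≡K = begin
    δ                 ≡⟨ sym (ℤ.+-identityˡ δ) ⟩
    ℤ.+ 0 ℤ.+ δ       ≡⟨ cong (λ y → ℤ.+ y ℤ.+ δ) (sym (offset-at 0 (proj₁ (proj₂ (rowHit zero))))) ⟩
    ℤ.+ Y t₀ ℤ.+ δ    ≡⟨ sym (X+Z≡Y+δ t₀) ⟩
    ℤ.+ K             ∎
    where open ≡-Reasoning
  Y+K≡X+Z : ∀ t → Y t + K ≡ X t + Z t
  Y+K≡X+Z t = ℤ.+-injective (trans (cong (ℤ._+_ (ℤ.+ Y t)) (sym δ≡K)) (sym (X+Z≡Y+δ t)))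
  K<m : K < suc m
  K<m = begin-strict
    K               ≤⟨ m≤n+m K (Y t₁) ⟩
    Y t₁ + K        ≡⟨ Y+K≡X+Z t₁ ⟩
    X t₁ + Z t₁     ≡⟨ cong (_+ Z t₁) (offset-at 0 (proj₁ (proj₂ (colHit zero)))) ⟩
    Z t₁            <⟨ Z<m t₁ ⟩
    suc m           ∎
    where open ≤-Reasoning
  same-difference : ∀ (f : Point → ℤ) {c₀} (fIn : ∀ t → c₀ ℤ.≤ f (d t) × f (d t) ℤ.< c₀ ℤ.+ ℤ.+ suc m)
    (F<m : ∀ t → offset c₀ (f (d t)) < suc m) {a b a' b'} →
    offset c₀ (f (d a)) + suc m ∸ offset c₀ (f (d b)) ≡ offset c₀ (f (d a')) + suc m ∸ offset c₀ (f (d b')) →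
    f (d a) ℤ.- f (d b) ≡ f (d a') ℤ.- f (d b')
  same-difference f {c₀} fIn F<m {a} {b} {a'} {b'} eq =
    trans (shifted a b) (trans (cong (λ n → ℤ.+ n ℤ.- ℤ.+ suc m) eq) (sym (shifted a' b')))
    where
    shifted : ∀ a b → f (d a) ℤ.- f (d b) ≡ ℤ.+ (offset c₀ (f (d a)) + suc m ∸ offset c₀ (f (d b))) ℤ.- ℤ.+ suc m
    shifted a b = difference-via-offsets (suc m) (proj₁ (fIn a)) (proj₁ (fIn b))
      (≤-trans (<⇒≤ (F<m b)) (m≤n+m (suc m) _))

⌊√_⌋-spec : ∀ n → Σ ℕ λ j → j * j ≤ n × n < suc j * suc j
⌊√_⌋-spec zero = 0 , z≤n , s≤s z≤n
⌊√_⌋-spec (suc n) with ⌊√_⌋-spec n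
... | j , j²≤n , n<[j+1]² with suc n <? suc j * suc j
...   | yes n+1<[j+1]² = j , ≤-trans j²≤n (n≤1+n n) , n+1<[j+1]²
...   | no  n+1≮[j+1]² = suc j , ≮⇒≥ n+1≮[j+1]² , ≤-trans (s≤s n<[j+1]²) (begin
  suc (suc j * suc j)                       ≤⟨ m≤m+n _ (2 * j + 2) ⟩
  suc (suc j * suc j) + (2 * j + 2)         ≡⟨ solve (j ∷ []) ⟩
  suc (suc j) * suc (suc j)                 ∎)
  where open ≤-Reasoning

-- The right-hand side of the window bound minus (m + k')², evaluated at x = m.
excess : ℕ → ℕ → ℕ
excess k' x = (x + k') * (3 * x + 5 * k') + 1

excess-mono : ∀ k' κ {x y} → x ≤ y → excess k' x * (x + κ) ≤ excess k' y * (y + κ)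
excess-mono k' κ x≤y = *-mono-≤
  (+-monoˡ-≤ 1 (*-mono-≤ (+-monoˡ-≤ k' x≤y) (+-monoˡ-≤ (5 * k') (*-monoʳ-≤ 3 x≤y))))
  (+-monoˡ-≤ κ x≤y)

window-inequality⇒excess : ∀ m k' κ →
  4 * (m * m * κ) + (m + k') * (m + k') * (m + κ) ≤ (2 * ((m + k') * (2 * m + 3 * k')) + 1) * (m + κ) →
  4 * (m * m * κ) ≤ excess k' m * (m + κ)
window-inequality⇒excess m k' κ ineq = +-cancelˡ-≤ S _ _ (begin
  S + 4 * (m * m * κ)                                       ≡⟨ +-comm S _ ⟩
  4 * (m * m * κ) + S                                       ≤⟨ ineq ⟩
  (2 * ((m + k') * (2 * m + 3 * k')) + 1) * (m + κ)         ≡⟨ split m k' κ ⟩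
  S + excess k' m * (m + κ)                                 ∎)
  where
  open ≤-Reasoning
  S = (m + k') * (m + k') * (m + κ)
  split : ∀ m k' κ → (2 * ((m + k') * (2 * m + 3 * k')) + 1) * (m + κ)
                   ≡ (m + k') * (m + k') * (m + κ) + ((m + k') * (3 * m + 5 * k') + 1) * (m + κ)
  split = solve-∀

-- j² + 2j is the largest m with ⌊√m⌋ = j.
excess<4j⁴k² : ∀ j → 70 ≤ j →
  excess (3 * j) (j * j + 2 * j) * (j * j + 2 * j + suc (3 * j) * suc (3 * j))
    < 4 * (j * j * (j * j)) * (suc (3 * j) * suc (3 * j))
excess<4j⁴k² j 70≤j = begin-strict
  excess (3 * j) (j * j + 2 * j) * (j * j + 2 * j + suc (3 * j) * suc (3 * j))
                                                        ≤⟨ *-mono-≤ excess≤ M+κ≤ ⟩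
  (j * j * (3 * (j * j) + 38 * j)) * (j * (10 * j + 9)) ≡⟨ factor-j⁴ j ⟩
  j * j * (j * j) * ((3 * j + 38) * (10 * j + 9))       <⟨ *-monoʳ-< (j * j * (j * j)) {{>-nonZero 0<j⁴}} quadratic ⟩
  j * j * (j * j) * (4 * (suc (3 * j) * suc (3 * j)))   ≡⟨ *-comm-4 j ⟩
  4 * (j * j * (j * j)) * (suc (3 * j) * suc (3 * j))  ∎
  where
  open ≤-Reasoning
  factor-j⁴ : ∀ j → (j * j * (3 * (j * j) + 38 * j)) * (j * (10 * j + 9)) ≡ j * j * (j * j) * ((3 * j + 38) * (10 * j + 9))
  factor-j⁴ = solve-∀
  *-comm-4 : ∀ j → j * j * (j * j) * (4 * (suc (3 * j) * suc (3 * j))) ≡ 4 * (j * j * (j * j)) * (suc (3 * j) * suc (3 * j))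
  *-comm-4 = solve-∀
  1≤j = ≤-trans (s≤s z≤n) 70≤j
  1≤j² = *-mono-≤ 1≤j 1≤j
  0<j⁴ : 0 < j * j * (j * j)
  0<j⁴ = *-mono-≤ 1≤j² 1≤j²
  excess≤ : excess (3 * j) (j * j + 2 * j) ≤ j * j * (3 * (j * j) + 38 * j)
  excess≤ = begin
    excess (3 * j) (j * j + 2 * j)                                   ≡⟨ expand j ⟩
    3 * (j * j * (j * j)) + 36 * (j * j * j) + 105 * (j * j) + 1     ≤⟨ +-monoʳ-≤ _ 1≤j² ⟩
    3 * (j * j * (j * j)) + 36 * (j * j * j) + 105 * (j * j) + j * j ≡⟨ collect j ⟩
    3 * (j * j * (j * j)) + 36 * (j * j * j) + j * j * 106           ≤⟨ +-monoʳ-≤ _ (*-monoʳ-≤ (j * j)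
                                                                          (*-monoʳ-≤ 2 (≤-trans (m≤m+n 53 17) 70≤j))) ⟩
    3 * (j * j * (j * j)) + 36 * (j * j * j) + j * j * (2 * j)       ≡⟨ factor j ⟩
    j * j * (3 * (j * j) + 38 * j)                                   ∎
    where
    expand : ∀ j → ((j * j + 2 * j) + 3 * j) * (3 * (j * j + 2 * j) + 5 * (3 * j)) + 1
                 ≡ 3 * (j * j * (j * j)) + 36 * (j * j * j) + 105 * (j * j) + 1
    expand = solve-∀
    collect : ∀ j → 3 * (j * j * (j * j)) + 36 * (j * j * j) + 105 * (j * j) + j * j
                  ≡ 3 * (j * j * (j * j)) + 36 * (j * j * j) + j * j * 106
    collect = solve-∀
    factor : ∀ j → 3 * (j * j * (j * j)) + 36 * (j * j * j) + j * j * (2 * j) ≡ j * j * (3 * (j * j) + 38 * j)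
    factor = solve-∀
  M+κ≤ : j * j + 2 * j + suc (3 * j) * suc (3 * j) ≤ j * (10 * j + 9)
  M+κ≤ = begin
    j * j + 2 * j + suc (3 * j) * suc (3 * j) ≡⟨ expand j ⟩
    10 * (j * j) + 8 * j + 1                  ≤⟨ +-monoʳ-≤ (10 * (j * j) + 8 * j) 1≤j ⟩
    10 * (j * j) + 8 * j + j                  ≡⟨ factor j ⟩
    j * (10 * j + 9)                          ∎
    where
    expand : ∀ j → j * j + 2 * j + suc (3 * j) * suc (3 * j) ≡ 10 * (j * j) + 8 * j + 1
    expand = solve-∀
    factor : ∀ j → 10 * (j * j) + 8 * j + j ≡ j * (10 * j + 9)
    factor = solve-∀
  quadratic : (3 * j + 38) * (10 * j + 9) < 4 * (suc (3 * j) * suc (3 * j))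
  quadratic = begin-strict
    (3 * j + 38) * (10 * j + 9)              <⟨ n<1+n _ ⟩
    suc ((3 * j + 38) * (10 * j + 9))        ≡⟨ expand j ⟩
    30 * (j * j) + 407 * j + 343             ≤⟨ +-monoʳ-≤ _ (≤-trans (m≤m+n 343 7) (*-monoʳ-≤ 5 70≤j)) ⟩
    30 * (j * j) + 407 * j + 5 * j           ≡⟨ collect j ⟩
    30 * (j * j) + 412 * j                   ≤⟨ +-monoʳ-≤ _ (*-monoˡ-≤ j (≤-trans (m≤m+n 412 8) (*-monoʳ-≤ 6 70≤j))) ⟩
    30 * (j * j) + 6 * j * j                 ≤⟨ m≤m+n _ (24 * j + 4) ⟩
    30 * (j * j) + 6 * j * j + (24 * j + 4)  ≡⟨ square j ⟩
    4 * (suc (3 * j) * suc (3 * j))          ∎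
    where
    expand : ∀ j → suc ((3 * j + 38) * (10 * j + 9)) ≡ 30 * (j * j) + 407 * j + 343
    expand = solve-∀
    collect : ∀ j → 30 * (j * j) + 407 * j + 5 * j ≡ 30 * (j * j) + 412 * j
    collect = solve-∀
    square : ∀ j → 30 * (j * j) + 6 * j * j + (24 * j + 4) ≡ 4 * (suc (3 * j) * suc (3 * j))
    square = solve-∀

window-inequality-fails : ∀ m j → j * j ≤ m → m < suc j * suc j → 70 ≤ j →
  let k' = 3 * j ; κ = suc k' * suc k' in
  ¬ (4 * (m * m * κ) + (m + k') * (m + k') * (m + κ) ≤ (2 * ((m + k') * (2 * m + 3 * k')) + 1) * (m + κ))
window-inequality-fails m j j²≤m m<[j+1]² 70≤j ineq = <⇒≱ (excess<4j⁴k² j 70≤j) (begin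
  4 * (j * j * (j * j)) * κ                 ≤⟨ *-monoˡ-≤ κ (*-monoʳ-≤ 4 (*-mono-≤ j²≤m j²≤m)) ⟩
  4 * (m * m) * κ                           ≡⟨ *-assoc 4 (m * m) κ ⟩
  4 * (m * m * κ)                           ≤⟨ window-inequality⇒excess m (3 * j) κ ineq ⟩
  excess (3 * j) m * (m + κ)                ≤⟨ excess-mono (3 * j) κ m≤j²+2j ⟩
  excess (3 * j) (j * j + 2 * j) * (j * j + 2 * j + κ) ∎)
  where
  open ≤-Reasoning
  κ = suc (3 * j) * suc (3 * j)
  m≤j²+2j : m ≤ j * j + 2 * j
  m≤j²+2j = ≤-pred (subst (m <_) (square j) m<[j+1]²)
    where
    square : ∀ j → suc j * suc j ≡ suc (j * j + 2 * j)
    square = solve-∀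

honeycomb-order≤4900 : ∀ m → HoneycombArrayExists m → m ≤ 4900
honeycomb-order≤4900 zero    _                = z≤n
honeycomb-order≤4900 (suc m) (_ , honeycomb) with suc m ≤? 4900
... | yes small = small
... | no  large = ⊥-elim (window-inequality-fails (suc m) j j²≤m m<[j+1]² 70≤j
                    (WindowArgument.window-bound (normalise honeycomb) (3 * j)))
  where
  j = proj₁ (⌊√_⌋-spec (suc m))
  j²≤m = proj₁ (proj₂ (⌊√_⌋-spec (suc m)))
  m<[j+1]² = proj₂ (proj₂ (⌊√_⌋-spec (suc m)))
  70≤j : 70 ≤ j
  70≤j with 70 ≤? j
  ... | yes 70≤j = 70≤j
  ... | no  j<70 = ⊥-elim (large (<⇒≤ (<-≤-trans m<[j+1]² (*-mono-≤ (≰⇒> j<70) (≰⇒> j<70)))))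

corollary2 : Σ ℕ λ N → ∀ (m : ℕ) → HoneycombArrayExists m → m ≤ N
corollary2 = 4900 , honeycomb-order≤4900
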